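{- The theory $T_{0} + \mathrm{IND}(\mathrm{Open}(\mathcal{L}_{0}))$ proves (i) $X \neq \mathit{cons}(x_1,\dots,x_n;X)$ for every $n \geq 1$; (ii) $X = \mathit{nil} \vee \exists x'\,\exists X'\, X = \mathit{cons}(x',X')$.
   Context: Many-sorted first-order logic with equality. The language $\mathcal{L}_{0}$ has sorts $\mathsf{i}$ (elements) and $\mathsf{list}$, and function symbols $\mathit{nil}:\mathsf{list}$, $\mathit{cons}:\mathsf{i}\times\mathsf{list}\to\mathsf{list}$. $T_{0}$ is axiomatized by the universal closures of $\mathit{nil}\neq\mathit{cons}(x,X)$ and $\mathit{cons}(x,X)=\mathit{cons}(y,Y)\rightarrow x=y\wedge X=Y$. $\mathit{cons}(t_1,\dots,t_n;T)$ abbreviates $\mathit{cons}(t_1,\mathit{cons}(t_2,\dots,\mathit{cons}(t_n,T)\dots))$. For a formula $\varphi(X,\vec z)$, the induction axiom $I_X\varphi$ is $\big(\varphi(\mathit{nil},\vec z)\wedge\forall X\,\forall x\,(\varphi(X,\vec z)\rightarrow\varphi(\mathit{cons}(x,X),\vec z))\big)\rightarrow\forall X\,\varphi(X,\vec z)$; $\mathrm{IND}(\Phi)$ is axiomatized by the universal closures of $I_X\varphi$ for $\varphi\in\Phi$. $\mathrm{Open}(\mathcal{L}_0)$ is the set of quantifier-free $\mathcal{L}_0$-formulas. -}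

module Defs where

open import Data.List using (List; []; _∷_; map)
open import Data.List.Membership.Propositional using (_∈_)
open import Data.Nat using (ℕ; zero; suc)

data Sort : Set where
  𝕚 𝕝 : Sort          -- 𝕚 = sort i (elements), 𝕝 = sort list

Ctx : Set
Ctx = List Sort

-- typed de Bruijn variables (head of the context = most recently bound)
data _∋_ : Ctx → Sort → Set where
  vz : ∀ {Γ s} → (s ∷ Γ) ∋ s
  vs : ∀ {Γ s t} → Γ ∋ s → (t ∷ Γ) ∋ s

data Term (Γ : Ctx) : Sort → Set where
  var  : ∀ {s} → Γ ∋ s → Term Γ s
  nil  : Term Γ 𝕝
  cons : Term Γ 𝕚 → Term Γ 𝕝 → Term Γ 𝕝

infix  6 _≐_
infixr 4 _⇒_
infixr 5 _∧_ _∨_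
data Form (Γ : Ctx) : Set where
  _≐_ : ∀ {s} → Term Γ s → Term Γ s → Form Γ
  ⊥'  : Form Γ
  _⇒_ _∧_ _∨_ : Form Γ → Form Γ → Form Γ
  ∀' ∃' : (s : Sort) → Form (s ∷ Γ) → Form Γ

¬' : ∀ {Γ} → Form Γ → Form Γ
¬' φ = φ ⇒ ⊥'

data QF {Γ : Ctx} : Form Γ → Set where
  qf-≐ : ∀ {s} {t u : Term Γ s} → QF (t ≐ u)
  qf-⊥ : QF ⊥'
  qf-⇒ : ∀ {φ ψ} → QF φ → QF ψ → QF (φ ⇒ ψ)
  qf-∧ : ∀ {φ ψ} → QF φ → QF ψ → QF (φ ∧ ψ)
  qf-∨ : ∀ {φ ψ} → QF φ → QF ψ → QF (φ ∨ ψ)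

Sub : Ctx → Ctx → Set
Sub Γ Δ = ∀ {s} → Γ ∋ s → Term Δ s

renT : ∀ {Γ Δ s} → (∀ {t} → Γ ∋ t → Δ ∋ t) → Term Γ s → Term Δ s
renT ρ (var x)    = var (ρ x)
renT ρ nil        = nil
renT ρ (cons t u) = cons (renT ρ t) (renT ρ u)

wkT : ∀ {Γ s t} → Term Γ s → Term (t ∷ Γ) s
wkT = renT vs

subT : ∀ {Γ Δ s} → Sub Γ Δ → Term Γ s → Term Δ s
subT σ (var x)    = σ x
subT σ nil        = nil
subT σ (cons t u) = cons (subT σ t) (subT σ u)

lift : ∀ {Γ Δ s} → Sub Γ Δ → Sub (s ∷ Γ) (s ∷ Δ)
lift σ vz     = var vz
lift σ (vs x) = wkT (σ x)

subF : ∀ {Γ Δ} → Sub Γ Δ → Form Γ → Form Δ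
subF σ (t ≐ u)  = subT σ t ≐ subT σ u
subF σ ⊥'       = ⊥'
subF σ (φ ⇒ ψ)  = subF σ φ ⇒ subF σ ψ
subF σ (φ ∧ ψ)  = subF σ φ ∧ subF σ ψ
subF σ (φ ∨ ψ)  = subF σ φ ∨ subF σ ψ
subF σ (∀' s φ) = ∀' s (subF (lift σ) φ)
subF σ (∃' s φ) = ∃' s (subF (lift σ) φ)

wkF : ∀ {Γ t} → Form Γ → Form (t ∷ Γ)
wkF = subF (λ x → var (vs x))

_[_] : ∀ {Γ s} → Form (s ∷ Γ) → Term Γ s → Form Γ
_[_] {Γ} {s} φ t = subF σ φ
  where
  σ : Sub (s ∷ Γ) Γ
  σ vz     = t
  σ (vs x) = var x

embed : ∀ {Γ} → Form [] → Form Γ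
embed = subF (λ ())

closeAll : ∀ Γ → Form Γ → Form []
closeAll []      φ = φ
closeAll (s ∷ Γ) φ = closeAll Γ (∀' s φ)

infix 2 _⊢[_]_
data _⊢[_]_ {Γ : Ctx} (Δ : List (Form Γ)) (Ax : Form [] → Set) : Form Γ → Set where
  ax   : ∀ {φ} → Ax φ → Δ ⊢[ Ax ] embed φ
  hyp  : ∀ {φ} → φ ∈ Δ → Δ ⊢[ Ax ] φ
  ⇒I   : ∀ {φ ψ} → (φ ∷ Δ) ⊢[ Ax ] ψ → Δ ⊢[ Ax ] φ ⇒ ψ
  ⇒E   : ∀ {φ ψ} → Δ ⊢[ Ax ] φ ⇒ ψ → Δ ⊢[ Ax ] φ → Δ ⊢[ Ax ] ψ
  ∧I   : ∀ {φ ψ} → Δ ⊢[ Ax ] φ → Δ ⊢[ Ax ] ψ → Δ ⊢[ Ax ] φ ∧ ψ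
  ∧E₁  : ∀ {φ ψ} → Δ ⊢[ Ax ] φ ∧ ψ → Δ ⊢[ Ax ] φ
  ∧E₂  : ∀ {φ ψ} → Δ ⊢[ Ax ] φ ∧ ψ → Δ ⊢[ Ax ] ψ
  ∨I₁  : ∀ {φ ψ} → Δ ⊢[ Ax ] φ → Δ ⊢[ Ax ] φ ∨ ψ
  ∨I₂  : ∀ {φ ψ} → Δ ⊢[ Ax ] ψ → Δ ⊢[ Ax ] φ ∨ ψ
  ∨E   : ∀ {φ ψ χ} → Δ ⊢[ Ax ] φ ∨ ψ → (φ ∷ Δ) ⊢[ Ax ] χ → (ψ ∷ Δ) ⊢[ Ax ] χ
         → Δ ⊢[ Ax ] χ
  ⊥E   : ∀ {φ} → Δ ⊢[ Ax ] ⊥' → Δ ⊢[ Ax ] φ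
  raa  : ∀ {φ} → (¬' φ ∷ Δ) ⊢[ Ax ] ⊥' → Δ ⊢[ Ax ] φ
  ∀I   : ∀ {s φ} → map wkF Δ ⊢[ Ax ] φ → Δ ⊢[ Ax ] ∀' s φ
  ∀E   : ∀ {s φ} → Δ ⊢[ Ax ] ∀' s φ → (t : Term Γ s) → Δ ⊢[ Ax ] φ [ t ]
  ∃I   : ∀ {s φ} (t : Term Γ s) → Δ ⊢[ Ax ] φ [ t ] → Δ ⊢[ Ax ] ∃' s φ
  ∃E   : ∀ {s φ ψ} → Δ ⊢[ Ax ] ∃' s φ → (φ ∷ map wkF Δ) ⊢[ Ax ] wkF ψ
         → Δ ⊢[ Ax ] ψ
  ≐refl  : ∀ {s} {t : Term Γ s} → Δ ⊢[ Ax ] t ≐ t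
  ≐subst : ∀ {s} {t u : Term Γ s} (φ : Form (s ∷ Γ))
         → Δ ⊢[ Ax ] t ≐ u → Δ ⊢[ Ax ] φ [ t ] → Δ ⊢[ Ax ] φ [ u ]

-- I_X φ, for φ(X, z⃗) with X the innermost variable and z⃗ the rest of Γ
IndAx : ∀ {Γ} → Form (𝕝 ∷ Γ) → Form Γ
IndAx {Γ} φ =
  (φ [ nil ] ∧ ∀' 𝕝 (∀' 𝕚 (φX ⇒ φcons))) ⇒ ∀' 𝕝 φ
  where
  -- context 𝕚 ∷ 𝕝 ∷ Γ : x = vz, X = vs vz
  σX : Sub (𝕝 ∷ Γ) (𝕚 ∷ 𝕝 ∷ Γ)
  σX vz     = var (vs vz)
  σX (vs y) = var (vs (vs y))
  σc : Sub (𝕝 ∷ Γ) (𝕚 ∷ 𝕝 ∷ Γ)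
  σc vz     = cons (var vz) (var (vs vz))
  σc (vs y) = var (vs (vs y))
  φX     = subF σX φ
  φcons  = subF σc φ

data T₀+IND-Open : Form [] → Set where
  nil≠cons  : T₀+IND-Open (∀' 𝕚 (∀' 𝕝 (¬' (nil ≐ cons (var (vs vz)) (var vz)))))
  cons-inj  : T₀+IND-Open
    (∀' 𝕚 (∀' 𝕝 (∀' 𝕚 (∀' 𝕝
      (cons (var (vs (vs (vs vz)))) (var (vs (vs vz))) ≐ cons (var (vs vz)) (var vz)
       ⇒ (var (vs (vs (vs vz))) ≐ var (vs vz) ∧ var (vs (vs vz)) ≐ var vz))))))
  ind       : ∀ Γ (φ : Form (𝕝 ∷ Γ)) → QF φ → T₀+IND-Open (closeAll Γ (IndAx φ))

-- context for (i): x₁ , … , xₙ , X   (x₁ innermost)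
ctxI : ℕ → Ctx
ctxI zero    = 𝕝 ∷ []
ctxI (suc n) = 𝕚 ∷ ctxI n

varX : ∀ n → Term (ctxI n) 𝕝
varX zero    = var vz
varX (suc n) = wkT (varX n)

consChain : ∀ n → Term (ctxI n) 𝕝
consChain zero    = var vz
consChain (suc n) = cons (var vz) (wkT (consChain n))

-- (i): injectivity turns cons(x, X) = cons(x₁, … , xₙ ; cons(x, X)) into
-- X = cons(x₂, … , xₙ, x₁ ; X), so X ≠ cons(x₁, … , xₙ ; X) is not inductive on its own.
-- The conjunction of X ≠ cons(R ; X) over the n rotations R of (x₁, … , xₙ) is, because the
-- rotations are closed under this step; its base case is nil ≠ cons(R ; nil).
-- (ii): if (ii) fails for Z, then ¬ (Z = X) satisfies the premises of open induction on X,
-- and its instance X := Z refutes Z = Z.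

module Submission where

open import Defs
open import Data.List using (List; []; _∷_; map; foldr; length; _++_; _∷ʳ_)
open import Data.List.Properties
  using (map-∘; map-cong; map-id; map-++; ++-assoc; ++-identityʳ; ∷ʳ-++; length-++; foldr-∷ʳ)
open import Data.List.Relation.Unary.Any using (here; there)
open import Data.Nat using (ℕ; zero; suc; _≥_; _<_; s≤s; z≤n)
open import Data.Nat.Properties using (+-comm; ≤-trans; m≤n⇒m<n∨m≡n)
open import Data.Product using (_×_; _,_; ∃-syntax)
open import Data.Sum using (inj₁; inj₂)
open import Relation.Binary.PropositionalEquality hiding ([_])
open ≡-Reasoning

Ren : Ctx → Ctx → Set
Ren Γ Δ = ∀ {s} → Γ ∋ s → Δ ∋ s

infix 4 _≗ₛ_
_≗ₛ_ : ∀ {Γ Δ} → Sub Γ Δ → Sub Γ Δ → Set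
σ ≗ₛ τ = ∀ {s} (x : _ ∋ s) → σ x ≡ τ x

subT-renT : ∀ {Γ Δ Θ s} (σ : Sub Δ Θ) (ρ : Ren Γ Δ) (t : Term Γ s)
          → subT σ (renT ρ t) ≡ subT (λ x → σ (ρ x)) t
subT-renT σ ρ (var x)    = refl
subT-renT σ ρ nil        = refl
subT-renT σ ρ (cons t u) = cong₂ cons (subT-renT σ ρ t) (subT-renT σ ρ u)

renT-subT : ∀ {Γ Δ Θ s} (ρ : Ren Δ Θ) (σ : Sub Γ Δ) (t : Term Γ s)
          → renT ρ (subT σ t) ≡ subT (λ x → renT ρ (σ x)) t
renT-subT ρ σ (var x)    = refl
renT-subT ρ σ nil        = refl
renT-subT ρ σ (cons t u) = cong₂ cons (renT-subT ρ σ t) (renT-subT ρ σ u)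

subT-cong : ∀ {Γ Δ s} {σ τ : Sub Γ Δ} → σ ≗ₛ τ → (t : Term Γ s) → subT σ t ≡ subT τ t
subT-cong σ≗τ (var x)    = σ≗τ x
subT-cong σ≗τ nil        = refl
subT-cong σ≗τ (cons t u) = cong₂ cons (subT-cong σ≗τ t) (subT-cong σ≗τ u)

subT-id : ∀ {Γ s} (t : Term Γ s) → subT var t ≡ t
subT-id (var x)    = refl
subT-id nil        = refl
subT-id (cons t u) = cong₂ cons (subT-id t) (subT-id u)

subT-subT : ∀ {Γ Δ Θ s} (τ : Sub Δ Θ) (σ : Sub Γ Δ) (t : Term Γ s)
          → subT τ (subT σ t) ≡ subT (λ x → subT τ (σ x)) t
subT-subT τ σ (var x)    = refl
subT-subT τ σ nil        = refl
subT-subT τ σ (cons t u) = cong₂ cons (subT-subT τ σ t) (subT-subT τ σ u)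

lift-cong : ∀ {Γ Δ s} {σ τ : Sub Γ Δ} → σ ≗ₛ τ → lift {s = s} σ ≗ₛ lift τ
lift-cong σ≗τ vz     = refl
lift-cong σ≗τ (vs x) = cong wkT (σ≗τ x)

lift-id : ∀ {Γ s} → lift {Γ} {Γ} {s} var ≗ₛ var
lift-id vz     = refl
lift-id (vs x) = refl

lift-subT : ∀ {Γ Δ Θ s} (τ : Sub Δ Θ) (σ : Sub Γ Δ)
          → (λ {t} (x : (s ∷ Γ) ∋ t) → subT (lift τ) (lift σ x)) ≗ₛ lift (λ x → subT τ (σ x))
lift-subT τ σ vz     = refl
lift-subT τ σ (vs x) = trans (subT-renT (lift τ) vs (σ x)) (sym (renT-subT vs τ (σ x)))

subF-cong : ∀ {Γ Δ} {σ τ : Sub Γ Δ} → σ ≗ₛ τ → (φ : Form Γ) → subF σ φ ≡ subF τ φ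
subF-cong σ≗τ (t ≐ u)  = cong₂ _≐_ (subT-cong σ≗τ t) (subT-cong σ≗τ u)
subF-cong σ≗τ ⊥'       = refl
subF-cong σ≗τ (φ ⇒ ψ)  = cong₂ _⇒_ (subF-cong σ≗τ φ) (subF-cong σ≗τ ψ)
subF-cong σ≗τ (φ ∧ ψ)  = cong₂ _∧_ (subF-cong σ≗τ φ) (subF-cong σ≗τ ψ)
subF-cong σ≗τ (φ ∨ ψ)  = cong₂ _∨_ (subF-cong σ≗τ φ) (subF-cong σ≗τ ψ)
subF-cong σ≗τ (∀' s φ) = cong (∀' s) (subF-cong (lift-cong σ≗τ) φ)
subF-cong σ≗τ (∃' s φ) = cong (∃' s) (subF-cong (lift-cong σ≗τ) φ)

subF-id : ∀ {Γ} (φ : Form Γ) → subF var φ ≡ φ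
subF-id (t ≐ u)  = cong₂ _≐_ (subT-id t) (subT-id u)
subF-id ⊥'       = refl
subF-id (φ ⇒ ψ)  = cong₂ _⇒_ (subF-id φ) (subF-id ψ)
subF-id (φ ∧ ψ)  = cong₂ _∧_ (subF-id φ) (subF-id ψ)
subF-id (φ ∨ ψ)  = cong₂ _∨_ (subF-id φ) (subF-id ψ)
subF-id (∀' s φ) = cong (∀' s) (trans (subF-cong lift-id φ) (subF-id φ))
subF-id (∃' s φ) = cong (∃' s) (trans (subF-cong lift-id φ) (subF-id φ))

subF-subF : ∀ {Γ Δ Θ} (τ : Sub Δ Θ) (σ : Sub Γ Δ) (φ : Form Γ)
          → subF τ (subF σ φ) ≡ subF (λ x → subT τ (σ x)) φ
subF-subF τ σ (t ≐ u)  = cong₂ _≐_ (subT-subT τ σ t) (subT-subT τ σ u)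
subF-subF τ σ ⊥'       = refl
subF-subF τ σ (φ ⇒ ψ)  = cong₂ _⇒_ (subF-subF τ σ φ) (subF-subF τ σ ψ)
subF-subF τ σ (φ ∧ ψ)  = cong₂ _∧_ (subF-subF τ σ φ) (subF-subF τ σ ψ)
subF-subF τ σ (φ ∨ ψ)  = cong₂ _∨_ (subF-subF τ σ φ) (subF-subF τ σ ψ)
subF-subF τ σ (∀' s φ) =
  cong (∀' s) (trans (subF-subF (lift τ) (lift σ) φ) (subF-cong (lift-subT τ σ) φ))
subF-subF τ σ (∃' s φ) =
  cong (∃' s) (trans (subF-subF (lift τ) (lift σ) φ) (subF-cong (lift-subT τ σ) φ))

sub₀ : ∀ {Γ s} → Term Γ s → Sub (s ∷ Γ) Γ
sub₀ t vz     = t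
sub₀ t (vs x) = var x

[]-sub₀ : ∀ {Γ s} (φ : Form (s ∷ Γ)) (t : Term Γ s) → φ [ t ] ≡ subF (sub₀ t) φ
[]-sub₀ φ t = subF-cong (λ { vz → refl ; (vs x) → refl }) φ

sub₀-wkT : ∀ {Γ s s′} (u : Term Γ s′) (t : Term Γ s) → subT (sub₀ u) (wkT t) ≡ t
sub₀-wkT u t = trans (subT-renT (sub₀ u) vs t) (subT-id t)

[]-lift : ∀ {Γ Θ s} (σ : Sub (s ∷ Γ) Θ) (φ : Form (s ∷ Γ))
        → subF (lift (λ x → σ (vs x))) φ [ σ vz ] ≡ subF σ φ
[]-lift σ φ = begin
  subF (lift σ′) φ [ σ vz ]                                ≡⟨ []-sub₀ (subF (lift σ′) φ) (σ vz) ⟩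
  subF (sub₀ (σ vz)) (subF (lift σ′) φ)                    ≡⟨ subF-subF (sub₀ (σ vz)) (lift σ′) φ ⟩
  subF (λ x → subT (sub₀ (σ vz)) (lift σ′ x)) φ            ≡⟨ subF-cong σ-restored φ ⟩
  subF σ φ                                                 ∎
  where
  σ′ = λ {t} (x : _ ∋ t) → σ (vs x)
  σ-restored : (λ {t} (x : _ ∋ t) → subT (sub₀ (σ vz)) (lift σ′ x)) ≗ₛ σ
  σ-restored vz     = refl
  σ-restored (vs x) = sub₀-wkT (σ vz) (σ (vs x))

map-subT-wkT : ∀ {Γ Δ s t} (σ : Sub (t ∷ Γ) Δ) (us : List (Term Γ s))
             → map (subT σ) (map wkT us) ≡ map (subT (λ x → σ (vs x))) us
map-subT-wkT σ us = trans (sym (map-∘ us)) (map-cong (subT-renT σ vs) us)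

map-subT-id : ∀ {Γ s} (us : List (Term Γ s)) → map (subT var) us ≡ us
map-subT-id us = trans (map-cong subT-id us) (map-id us)

infix 2 _⊢_
_⊢_ : ∀ {Γ} → List (Form Γ) → Form Γ → Set
Δ ⊢ φ = Δ ⊢[ T₀+IND-Open ] φ

cast : ∀ {Γ} {Δ : List (Form Γ)} {φ ψ} → φ ≡ ψ → Δ ⊢ φ → Δ ⊢ ψ
cast refl d = d

closeAll-elim : ∀ {Θ} {Δ : List (Form Θ)} Γ (ψ : Form Γ) (σ : Sub Γ Θ)
              → Δ ⊢ embed (closeAll Γ ψ) → Δ ⊢ subF σ ψ
closeAll-elim []      ψ σ d = cast (subF-cong (λ ()) ψ) d
closeAll-elim (s ∷ Γ) ψ σ d =
  cast ([]-lift σ ψ) (∀E (closeAll-elim Γ (∀' s ψ) (λ x → σ (vs x)) d) (σ vz))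

nil≢cons : ∀ {Γ} {Δ : List (Form Γ)} {a A} → Δ ⊢ nil ≐ cons a A → Δ ⊢ ⊥'
nil≢cons {a = a} {A} h =
  ⇒E (closeAll-elim (𝕝 ∷ 𝕚 ∷ []) (¬' (nil ≐ cons (var (vs vz)) (var vz))) σ (ax nil≠cons)) h
  where
  σ : Sub (𝕝 ∷ 𝕚 ∷ []) _
  σ vz      = A
  σ (vs vz) = a

cons-injective : ∀ {Γ} {Δ : List (Form Γ)} {a A b B}
               → Δ ⊢ cons a A ≐ cons b B → Δ ⊢ a ≐ b ∧ A ≐ B
cons-injective {a = a} {A} {b} {B} h =
  ⇒E (closeAll-elim (𝕝 ∷ 𝕚 ∷ 𝕝 ∷ 𝕚 ∷ []) (a′A′≐b′B′ ⇒ (a′ ≐ b′ ∧ A′ ≐ B′)) σ (ax cons-inj)) h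
  where
  σ : Sub (𝕝 ∷ 𝕚 ∷ 𝕝 ∷ 𝕚 ∷ []) _
  σ vz                = B
  σ (vs vz)           = b
  σ (vs (vs vz))      = A
  σ (vs (vs (vs vz))) = a
  a′ = var (vs (vs (vs vz)))
  A′ = var (vs (vs vz))
  b′ = var (vs vz)
  B′ = var vz
  a′A′≐b′B′ = cons a′ A′ ≐ cons b′ B′

-- In the step of I_X φ the variables are x = vz and X = vs vz; these substitutions
-- produce φ(X) and φ(cons(x, X)) there.
keepX consX : ∀ {Γ} → Sub (𝕝 ∷ Γ) (𝕚 ∷ 𝕝 ∷ Γ)
keepX vz     = var (vs vz)
keepX (vs y) = var (vs (vs y))
consX vz     = cons (var vz) (var (vs vz))
consX (vs y) = var (vs (vs y))

open-induction : ∀ {Γ} {Δ : List (Form Γ)} {φ : Form (𝕝 ∷ Γ)} → QF φ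
               → Δ ⊢ φ [ nil ]
               → (subF keepX φ ∷ map wkF (map wkF Δ)) ⊢ subF consX φ
               → Δ ⊢ ∀' 𝕝 φ
open-induction {Γ} {Δ} {φ} qf base step =
  ⇒E (cast IndAx-unfold (closeAll-elim Γ (IndAx φ) var (ax (ind Γ φ qf))))
     (∧I base (∀I (∀I (⇒I step))))
  where
  IndAx-unfold : subF var (IndAx φ)
               ≡ ((φ [ nil ] ∧ ∀' 𝕝 (∀' 𝕚 (subF keepX φ ⇒ subF consX φ))) ⇒ ∀' 𝕝 φ)
  IndAx-unfold = trans (subF-id (IndAx φ)) (cong (λ χ → (φ [ nil ] ∧ ∀' 𝕝 (∀' 𝕚 χ)) ⇒ ∀' 𝕝 φ)
    (cong₂ _⇒_ (subF-cong (λ { vz → refl ; (vs y) → refl }) φ)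
               (subF-cong (λ { vz → refl ; (vs y) → refl }) φ)))

module _ {A : Set} where

  rotate : List A → List A
  rotate []       = []
  rotate (x ∷ xs) = xs ∷ʳ x

  rotate^ : ℕ → List A → List A
  rotate^ zero    xs = xs
  rotate^ (suc k) xs = rotate (rotate^ k xs)

  length-rotate : ∀ xs → length (rotate xs) ≡ length xs
  length-rotate []       = refl
  length-rotate (x ∷ xs) = trans (length-++ xs) (+-comm (length xs) 1)

  length-rotate^ : ∀ k xs → length (rotate^ k xs) ≡ length xs
  length-rotate^ zero    xs = refl
  length-rotate^ (suc k) xs = trans (length-rotate (rotate^ k xs)) (length-rotate^ k xs)

  rotate^-suc : ∀ k xs → rotate^ (suc k) xs ≡ rotate^ k (rotate xs)
  rotate^-suc zero    xs = refl
  rotate^-suc (suc k) xs = cong rotate (rotate^-suc k xs)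

  rotate^-++ : ∀ xs ys → rotate^ (length xs) (xs ++ ys) ≡ ys ++ xs
  rotate^-++ []       ys = sym (++-identityʳ ys)
  rotate^-++ (x ∷ xs) ys = begin
    rotate^ (suc (length xs)) (x ∷ xs ++ ys)  ≡⟨ rotate^-suc (length xs) (x ∷ xs ++ ys) ⟩
    rotate^ (length xs) ((xs ++ ys) ∷ʳ x)     ≡⟨ cong (rotate^ (length xs)) (++-assoc xs ys (x ∷ [])) ⟩
    rotate^ (length xs) (xs ++ ys ∷ʳ x)       ≡⟨ rotate^-++ xs (ys ∷ʳ x) ⟩
    ys ∷ʳ x ++ xs                             ≡⟨ ∷ʳ-++ ys x xs ⟩
    ys ++ x ∷ xs                              ∎

  rotate^-length : ∀ xs → rotate^ (length xs) xs ≡ xs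
  rotate^-length xs = trans (cong (rotate^ (length xs)) (sym (++-identityʳ xs))) (rotate^-++ xs [])

  rotate-rotate^ : ∀ {i} xs → i < length xs
                 → ∃[ j ] j < length xs × rotate (rotate^ i xs) ≡ rotate^ j xs
  rotate-rotate^ {i} xs i<n with m≤n⇒m<n∨m≡n i<n
  ... | inj₁ 1+i<n = suc i , 1+i<n , refl
  ... | inj₂ 1+i≡n = zero , ≤-trans (s≤s z≤n) i<n ,
                     trans (cong (λ k → rotate^ k xs) 1+i≡n) (rotate^-length xs)

map-rotate : ∀ {A B : Set} (f : A → B) xs → map f (rotate xs) ≡ rotate (map f xs)
map-rotate f []       = refl
map-rotate f (x ∷ xs) = map-++ f xs (x ∷ [])

chain : ∀ {Γ} → List (Term Γ 𝕚) → Term Γ 𝕝 → Term Γ 𝕝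
chain ts T = foldr cons T ts

subT-chain : ∀ {Γ Δ} (σ : Sub Γ Δ) ts T
           → subT σ (chain ts T) ≡ chain (map (subT σ) ts) (subT σ T)
subT-chain σ []       T = refl
subT-chain σ (t ∷ ts) T = cong (cons (subT σ t)) (subT-chain σ ts T)

renT-chain : ∀ {Γ Δ} (ρ : Ren Γ Δ) ts T
           → renT ρ (chain ts T) ≡ chain (map (renT ρ) ts) (renT ρ T)
renT-chain ρ []       T = refl
renT-chain ρ (t ∷ ts) T = cong (cons (renT ρ t)) (renT-chain ρ ts T)

⋀ : ∀ {Γ} → ℕ → (ℕ → Form Γ) → Form Γ
⋀ zero    φ = ¬' ⊥'
⋀ (suc n) φ = φ zero ∧ ⋀ n (λ i → φ (suc i))

⋀-qf : ∀ {Γ} n {φ : ℕ → Form Γ} → (∀ i → QF (φ i)) → QF (⋀ n φ)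
⋀-qf zero    qf = qf-⇒ qf-⊥ qf-⊥
⋀-qf (suc n) qf = qf-∧ (qf zero) (⋀-qf n (λ i → qf (suc i)))

subF-⋀ : ∀ {Γ Δ} (σ : Sub Γ Δ) n (φ : ℕ → Form Γ) → subF σ (⋀ n φ) ≡ ⋀ n (λ i → subF σ (φ i))
subF-⋀ σ zero    φ = refl
subF-⋀ σ (suc n) φ = cong (subF σ (φ zero) ∧_) (subF-⋀ σ n (λ i → φ (suc i)))

⋀-cong : ∀ {Γ} n {φ ψ : ℕ → Form Γ} → (∀ i → φ i ≡ ψ i) → ⋀ n φ ≡ ⋀ n ψ
⋀-cong zero    φ≡ψ = refl
⋀-cong (suc n) φ≡ψ = cong₂ _∧_ (φ≡ψ zero) (⋀-cong n (λ i → φ≡ψ (suc i)))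

⋀-intro : ∀ {Γ} {Δ : List (Form Γ)} n {φ : ℕ → Form Γ}
        → (∀ {i} → i < n → Δ ⊢ φ i) → Δ ⊢ ⋀ n φ
⋀-intro zero    d = ⇒I (hyp (here refl))
⋀-intro (suc n) d = ∧I (d (s≤s z≤n)) (⋀-intro n (λ i<n → d (s≤s i<n)))

⋀-elim : ∀ {Γ} {Δ : List (Form Γ)} {n} {φ : ℕ → Form Γ} {i} → i < n → Δ ⊢ ⋀ n φ → Δ ⊢ φ i
⋀-elim {i = zero}  (s≤s _)   d = ∧E₁ d
⋀-elim {i = suc i} (s≤s i<n) d = ⋀-elim i<n (∧E₂ d)

noCycle : ∀ {Γ} → Term Γ 𝕝 → List (Term Γ 𝕚) → Form Γ
noCycle T ts = ¬' (T ≐ chain ts T)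

noCycle-rotate^ : ∀ {Γ} → List (Term Γ 𝕚) → ℕ → Form (𝕝 ∷ Γ)
noCycle-rotate^ L i = noCycle (var vz) (map wkT (rotate^ i L))

rotationsNoCycle : ∀ {Γ} → List (Term Γ 𝕚) → Form (𝕝 ∷ Γ)
rotationsNoCycle L = ⋀ (length L) (noCycle-rotate^ L)

subF-rotationsNoCycle : ∀ {Γ Θ} (σ : Sub (𝕝 ∷ Γ) Θ) L
  → subF σ (rotationsNoCycle L)
  ≡ ⋀ (length L) (λ i → noCycle (σ vz) (map (subT (λ x → σ (vs x))) (rotate^ i L)))
subF-rotationsNoCycle σ L = trans (subF-⋀ σ (length L) _) (⋀-cong (length L) λ i →
  cong (λ T → ¬' (σ vz ≐ T))
    (trans (subT-chain σ (map wkT (rotate^ i L)) (var vz))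
           (cong (λ ts → chain ts (σ vz)) (map-subT-wkT σ (rotate^ i L)))))

chain-rotate : ∀ {Γ} {Δ : List (Form Γ)} {a A} ts
             → Δ ⊢ cons a A ≐ chain ts (cons a A) → Δ ⊢ A ≐ chain (rotate ts) A
chain-rotate []                  _ = ≐refl
chain-rotate {a = a} {A} (b ∷ bs) h =
  cast (cong (A ≐_) (sym (foldr-∷ʳ cons A b bs)))
       (cast ψ[ b ] (≐subst ψ (∧E₁ injective) (cast (sym ψ[ a ]) (∧E₂ injective))))
  where
  injective = cons-injective h
  ψ : Form (𝕚 ∷ _)
  ψ = wkT A ≐ chain (map wkT bs) (cons (var vz) (wkT A))
  ψ[_] : ∀ u → ψ [ u ] ≡ (A ≐ chain bs (cons u A))
  ψ[ u ] = trans ([]-sub₀ ψ u) (cong₂ _≐_ (sub₀-wkT u A)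
    (trans (subT-chain (sub₀ u) (map wkT bs) _)
           (cong₂ chain (trans (map-subT-wkT (sub₀ u) bs) (map-subT-id bs))
                        (cong (cons u) (sub₀-wkT u A)))))

∀-rotationsNoCycle : ∀ {Γ} {Δ : List (Form Γ)} l ls → Δ ⊢ ∀' 𝕝 (rotationsNoCycle (l ∷ ls))
∀-rotationsNoCycle {Γ} {Δ} l ls =
  open-induction {φ = φ} (⋀-qf (length L) {noCycle-rotate^ L} (λ i → qf-⇒ qf-≐ qf-⊥))
    (cast (sym (trans ([]-sub₀ φ nil) (subF-rotationsNoCycle (sub₀ nil) L)))
          (⋀-intro (length L) (λ {i} _ → base i)))
    (cast (sym (subF-rotationsNoCycle consX L)) (⋀-intro (length L) step))
  where
  L = l ∷ ls
  φ = rotationsNoCycle L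
  base : ∀ i → Δ ⊢ noCycle nil (map (subT var) (rotate^ i L))
  -- matching on the length equation rules out an empty rotation
  base i with rotate^ i L | length-rotate^ i L
  ... | r ∷ R | _ = ⇒I (nil≢cons (hyp (here refl)))
  wk₂ : ∀ {s} → Term Γ s → Term (𝕚 ∷ 𝕝 ∷ Γ) s
  wk₂ = subT (λ y → var (vs (vs y)))
  X = var {𝕚 ∷ 𝕝 ∷ Γ} (vs vz)
  Δ₂ = subF keepX φ ∷ map wkF (map wkF Δ)
  step : ∀ {i} → i < length L → Δ₂ ⊢ noCycle (cons (var vz) X) (map wk₂ (rotate^ i L))
  step {i} i<n with rotate-rotate^ L i<n
  ... | j , j<n , rotate-i≡j = ⇒I (⇒E (⋀-elim {φ = IH-at} j<n IH) (cast chain≡ X≐rotated))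
    where
    IH-at : ℕ → Form (𝕚 ∷ 𝕝 ∷ Γ)
    IH-at k = noCycle X (map wk₂ (rotate^ k L))
    IH : (_ ∷ Δ₂) ⊢ ⋀ (length L) IH-at
    IH = cast (subF-rotationsNoCycle keepX L) (hyp (there (here refl)))
    X≐rotated = chain-rotate (map wk₂ (rotate^ i L)) (hyp (here refl))
    chain≡ : (X ≐ chain (rotate (map wk₂ (rotate^ i L))) X) ≡ (X ≐ chain (map wk₂ (rotate^ j L)) X)
    chain≡ = cong (λ ts → X ≐ chain ts X)
      (trans (sym (map-rotate wk₂ (rotate^ i L))) (cong (map wk₂) rotate-i≡j))

noCycle-∷ : ∀ {Γ} {Δ : List (Form Γ)} t ts T → Δ ⊢ noCycle T (t ∷ ts)
noCycle-∷ {Γ} {Δ} t ts T =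
  cast (cong (noCycle T) (map-subT-id L)) (⋀-elim {φ = φT} (s≤s z≤n) all-φT)
  where
  L = t ∷ ts
  φT : ℕ → Form Γ
  φT i = noCycle T (map (subT var) (rotate^ i L))
  all-φT : Δ ⊢ ⋀ (length L) φT
  all-φT = cast (trans ([]-sub₀ (rotationsNoCycle L) T) (subF-rotationsNoCycle (sub₀ T) L))
              (∀E (∀-rotationsNoCycle t ts) T)

elemVars : ∀ n → List (Term (ctxI n) 𝕚)
elemVars zero    = []
elemVars (suc n) = var vz ∷ map wkT (elemVars n)

chain-elemVars : ∀ n → chain (elemVars n) (varX n) ≡ consChain n
chain-elemVars zero    = refl
chain-elemVars (suc n) = cong (cons (var vz))
  (trans (sym (renT-chain vs (elemVars n) (varX n))) (cong wkT (chain-elemVars n)))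

X≢consChain : (n : ℕ) → n ≥ 1 → [] ⊢ ¬' (varX n ≐ consChain n)
X≢consChain (suc n) _ = cast (cong (λ T → ¬' (varX (suc n) ≐ T)) (chain-elemVars (suc n)))
  (noCycle-∷ (var vz) (map wkT (elemVars n)) (varX (suc n)))

nil-or-cons : [] ⊢ (var {𝕝 ∷ []} vz ≐ nil)
              ∨ ∃' 𝕚 (∃' 𝕝 (var (vs (vs vz)) ≐ cons (var (vs vz)) (var vz)))
nil-or-cons = raa (⇒E (∀E (open-induction {φ = Z≢X} (qf-⇒ qf-≐ qf-⊥) base step) (var vz)) ≐refl)
  where
  Z≢X : Form (𝕝 ∷ 𝕝 ∷ [])
  Z≢X = ¬' (var (vs vz) ≐ var vz)
  base = ⇒I (⇒E (hyp (there (here refl))) (∨I₁ (hyp (here refl))))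
  step = ⇒I (⇒E (hyp (there (there (here refl))))
                (∨I₂ (∃I (var vz) (∃I (var (vs vz)) (hyp (here refl))))))

lemma3p2 : ((n : ℕ) → n ≥ 1 → [] ⊢[ T₀+IND-Open ] ¬' (varX n ≐ consChain n))
    × ([] ⊢[ T₀+IND-Open ] (var {𝕝 ∷ []} vz ≐ nil)
    ∨ ∃' 𝕚 (∃' 𝕝 (var (vs (vs vz)) ≐ cons (var (vs vz)) (var vz))))
lemma3p2 = X≢consChain , nil-or-cons
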